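{- Let $\mathcal C$ be a tidy LD category and let $f$ be a morphism whose target is an $\otimes$-product. Then for every $u\in\mathfrak Y$ the natural transformations $\tau^f_u$ satisfy $\tau^f_{\alpha u}\circ\alpha=(\alpha\otimes\mathrm{id})\circ\tau^f_{\alpha\alpha u}$, $\tau^f_{\alpha^{ -1}\alpha u}\circ\alpha=\tau^f_{\alpha\alpha^{ -1}u}$, $\tau^f_{\alpha^{ -1}\alpha^{ -1}u}\circ\alpha=(\mathrm{id}\otimes\alpha)\circ\tau^f_{\alpha^{ -1}u}$, $\tau^f_{\alpha^{ -1}u}\circ\alpha^{ -1}=(\mathrm{id}\otimes\alpha^{ -1})\circ\tau^f_{\alpha^{ -1}\alpha^{ -1}u}$, $\tau^f_{\alpha\alpha^{ -1}u}\circ\alpha^{ -1}=\tau^f_{\alpha^{ -1}\alpha u}$, $\tau^f_{\alpha\alpha u}\circ\alpha^{ -1}=(\alpha^{ -1}\otimes\mathrm{id})\circ\tau^f_{\alpha u}$, as equalities of natural transformations with the evident components; e.g. the first means $\tau^f_{\alpha u}(A_1\otimes A_2,\vec A_{\ge3})\circ\alpha_{A_1,A_2,H^f_u(\vec A_{\ge3})}=(\alpha_{A_1,A_2,L^f_u(\vec A_{\ge3})}\otimes R^f_u(\vec A_{\ge3}))\circ\tau^f_{\alpha\alpha u}(\vec A)$ for all $\vec A\in\mathcal C^{|u|+2}$.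
   Context: $\mathcal C$ is a unitless LD category: bifunctors $\otimes,\odot$ (no units), natural isomorphisms $\alpha_{A,B,C}:A\otimes(B\otimes C)\to(A\otimes B)\otimes C$, $\bar\alpha_{A,B,C}:A\odot(B\odot C)\to(A\odot B)\odot C$, natural transformations $\delta^l_{A,B,C}:A\otimes(B\odot C)\to(A\otimes B)\odot C$, $\delta^r_{A,B,C}:(A\odot B)\otimes C\to A\odot(B\otimes C)$, satisfying the eight pentagon axioms, among them (P1) $\alpha_{A\otimes B,C,D}\circ\alpha_{A,B,C\otimes D}=(\alpha_{A,B,C}\otimes D)\circ\alpha_{A,B\otimes C,D}\circ(A\otimes\alpha_{B,C,D})$ and the others: (P2) $\delta^l_{A\otimes B,C,D}\circ\alpha_{A,B,C\odot D}=(\alpha_{A,B,C}\odot D)\circ\delta^l_{A,B\otimes C,D}\circ(A\otimes\delta^l_{B,C,D})$; (P3) $\delta^l_{A,B,C\otimes D}\circ(A\otimes\delta^r_{B,C,D})=\delta^r_{A\otimes B,C,D}\circ(\delta^l_{A,B,C}\otimes D)\circ\alpha_{A,B\odot C,D}$; (P4) $\bar\alpha_{A\otimes B,C,D}\circ\delta^l_{A,B,C\odot D}=(\delta^l_{A,B,C}\odot D)\circ\delta^l_{A,B\odot C,D}\circ(A\otimes\bar\alpha_{B,C,D})$; (P5) $(A\odot\alpha_{B,C,D})\circ\delta^r_{A,B,C\otimes D}=\delta^r_{A,B\otimes C,D}\circ(\delta^r_{A,B,C}\otimes D)\circ\alpha_{A\odot B,C,D}$; (P6) $(\delta^r_{A,B,C}\odot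 D)\circ\delta^l_{A\odot B,C,D}=\bar\alpha_{A,B\otimes C,D}\circ(A\odot\delta^l_{B,C,D})\circ\delta^r_{A,B,C\odot D}$; (P7) $\delta^r_{A\odot B,C,D}\circ(\bar\alpha_{A,B,C}\otimes D)=\bar\alpha_{A,B,C\otimes D}\circ(A\odot\delta^r_{B,C,D})\circ\delta^r_{A,B\odot C,D}$; (P8) $\bar\alpha_{A\odot B,C,D}\circ\bar\alpha_{A,B,C\odot D}=(\bar\alpha_{A,B,C}\odot D)\circ\bar\alpha_{A,B\odot C,D}\circ(A\odot\bar\alpha_{B,C,D})$ (objects denote identities). Tidy: $A_1\otimes A_2=B_1\otimes B_2\Rightarrow A_i=B_i$, same for $\odot$, and $A_1\otimes A_2\ne B_1\odot B_2$. An $\otimes$-product is an object of the form $A_1\otimes A_2$. $\mathfrak Y$ is the free monoid on the two letters $\alpha,\alpha^{ -1}$ (formal symbols), words written so that in $gu$ the letter $g$ is applied last. For a vector $\vec A=(A_1,\dots,A_n)$, $\vec A_{\ge k}=(A_k,\dots,A_n)$, $\vec A_{\le k}=(A_1,\dots,A_k)$. For $f:H\to L\otimes R$ and $u\in\mathfrak Y$, functors $H^f_u,L^f_u,R^f_u:\mathcal C^{|u|}\to\mathcal C$: $H^f_\emptyset=H$, $L^f_\emptyset=L$, $R^f_\emptyset=R$; $H^f_{\alpha u}(\vec A)=A_1\otimes H^f_u(\vec A_{\ge2})$, $L^f_{\alpha u}(\vec A)=A_1\otimes L^f_u(\vec A_{\ge2})$, $R^f_{\alpha u}(\vec A)=R^f_u(\vec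 A_{\ge2})$; $H^f_{\alpha^{ -1}u}(\vec A)=H^f_u(\vec A_{\le|u|})\otimes A_{|u|+1}$, $L^f_{\alpha^{ -1}u}(\vec A)=L^f_u(\vec A_{\le|u|})$, $R^f_{\alpha^{ -1}u}(\vec A)=R^f_u(\vec A_{\le|u|})\otimes A_{|u|+1}$. Natural transformations $\tau^f_u:H^f_u\to L^f_u\otimes R^f_u$: $\tau^f_\emptyset=f$, $\tau^f_{\alpha u}(\vec A)=\alpha_{A_1,L^f_u(\vec A_{\ge2}),R^f_u(\vec A_{\ge2})}\circ(A_1\otimes\tau^f_u(\vec A_{\ge2}))$, $\tau^f_{\alpha^{ -1}u}(\vec A)=\alpha^{ -1}_{L^f_u(\vec A_{\le|u|}),R^f_u(\vec A_{\le|u|}),A_{|u|+1}}\circ(\tau^f_u(\vec A_{\le|u|})\otimes A_{|u|+1})$. -}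

module Defs where

open import Level using (Level; _⊔_; suc)
open import Relation.Binary using (Rel; IsEquivalence)
open import Relation.Binary.PropositionalEquality using (_≡_)
open import Relation.Nullary using (¬_)
open import Data.Product using (_×_; _,_)
open import Data.List using (List; []; _∷_)
open import Data.Unit.Polymorphic using (⊤)

-- Unitless LD categories (hom-sets are setoids).

record LDCategory (o ℓ e : Level) : Set (suc (o ⊔ ℓ ⊔ e)) where
  infixr 9 _∘_
  infix  4 _≈_ _⇒_
  infixr 10 _⊗₀_ _⊙₀_ _⊗₁_ _⊙₁_
  field
    Obj  : Set o
    _⇒_  : Obj → Obj → Set ℓ
    _≈_  : ∀ {A B} → Rel (A ⇒ B) e
    id   : ∀ {A} → A ⇒ A
    _∘_  : ∀ {A B C} → B ⇒ C → A ⇒ B → A ⇒ C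
    equiv     : ∀ {A B} → IsEquivalence (_≈_ {A} {B})
    ∘-resp-≈  : ∀ {A B C} {f h : B ⇒ C} {g i : A ⇒ B} → f ≈ h → g ≈ i → f ∘ g ≈ h ∘ i
    assoc     : ∀ {A B C D} {f : A ⇒ B} {g : B ⇒ C} {h : C ⇒ D} → (h ∘ g) ∘ f ≈ h ∘ (g ∘ f)
    identityˡ : ∀ {A B} {f : A ⇒ B} → id ∘ f ≈ f
    identityʳ : ∀ {A B} {f : A ⇒ B} → f ∘ id ≈ f

    _⊗₀_ : Obj → Obj → Obj
    _⊗₁_ : ∀ {A B C D} → A ⇒ B → C ⇒ D → (A ⊗₀ C) ⇒ (B ⊗₀ D)
    ⊗-identity     : ∀ {A B} → id {A} ⊗₁ id {B} ≈ id
    ⊗-homomorphism : ∀ {A B C D E F} {f : A ⇒ B} {g : B ⇒ C} {h : D ⇒ E} {k : E ⇒ F} →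
                     (g ∘ f) ⊗₁ (k ∘ h) ≈ (g ⊗₁ k) ∘ (f ⊗₁ h)
    ⊗-resp-≈       : ∀ {A B C D} {f g : A ⇒ B} {h k : C ⇒ D} → f ≈ g → h ≈ k → f ⊗₁ h ≈ g ⊗₁ k

    _⊙₀_ : Obj → Obj → Obj
    _⊙₁_ : ∀ {A B C D} → A ⇒ B → C ⇒ D → (A ⊙₀ C) ⇒ (B ⊙₀ D)
    ⊙-identity     : ∀ {A B} → id {A} ⊙₁ id {B} ≈ id
    ⊙-homomorphism : ∀ {A B C D E F} {f : A ⇒ B} {g : B ⇒ C} {h : D ⇒ E} {k : E ⇒ F} →
                     (g ∘ f) ⊙₁ (k ∘ h) ≈ (g ⊙₁ k) ∘ (f ⊙₁ h)
    ⊙-resp-≈       : ∀ {A B C D} {f g : A ⇒ B} {h k : C ⇒ D} → f ≈ g → h ≈ k → f ⊙₁ h ≈ g ⊙₁ k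

    α   : ∀ A B C → A ⊗₀ (B ⊗₀ C) ⇒ (A ⊗₀ B) ⊗₀ C
    α⁻¹ : ∀ A B C → (A ⊗₀ B) ⊗₀ C ⇒ A ⊗₀ (B ⊗₀ C)
    α-isoˡ : ∀ {A B C} → α⁻¹ A B C ∘ α A B C ≈ id
    α-isoʳ : ∀ {A B C} → α A B C ∘ α⁻¹ A B C ≈ id
    α-natural : ∀ {A A' B B' C C'} (f : A ⇒ A') (g : B ⇒ B') (h : C ⇒ C') →
                α A' B' C' ∘ (f ⊗₁ (g ⊗₁ h)) ≈ ((f ⊗₁ g) ⊗₁ h) ∘ α A B C

    ᾱ   : ∀ A B C → A ⊙₀ (B ⊙₀ C) ⇒ (A ⊙₀ B) ⊙₀ C
    ᾱ⁻¹ : ∀ A B C → (A ⊙₀ B) ⊙₀ C ⇒ A ⊙₀ (B ⊙₀ C)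
    ᾱ-isoˡ : ∀ {A B C} → ᾱ⁻¹ A B C ∘ ᾱ A B C ≈ id
    ᾱ-isoʳ : ∀ {A B C} → ᾱ A B C ∘ ᾱ⁻¹ A B C ≈ id
    ᾱ-natural : ∀ {A A' B B' C C'} (f : A ⇒ A') (g : B ⇒ B') (h : C ⇒ C') →
                ᾱ A' B' C' ∘ (f ⊙₁ (g ⊙₁ h)) ≈ ((f ⊙₁ g) ⊙₁ h) ∘ ᾱ A B C

    δˡ : ∀ A B C → A ⊗₀ (B ⊙₀ C) ⇒ (A ⊗₀ B) ⊙₀ C
    δʳ : ∀ A B C → (A ⊙₀ B) ⊗₀ C ⇒ A ⊙₀ (B ⊗₀ C)
    δˡ-natural : ∀ {A A' B B' C C'} (f : A ⇒ A') (g : B ⇒ B') (h : C ⇒ C') →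
                 δˡ A' B' C' ∘ (f ⊗₁ (g ⊙₁ h)) ≈ ((f ⊗₁ g) ⊙₁ h) ∘ δˡ A B C
    δʳ-natural : ∀ {A A' B B' C C'} (f : A ⇒ A') (g : B ⇒ B') (h : C ⇒ C') →
                 δʳ A' B' C' ∘ ((f ⊙₁ g) ⊗₁ h) ≈ (f ⊙₁ (g ⊗₁ h)) ∘ δʳ A B C

    P1 : ∀ A B C D → α (A ⊗₀ B) C D ∘ α A B (C ⊗₀ D)
                     ≈ (α A B C ⊗₁ id) ∘ α A (B ⊗₀ C) D ∘ (id ⊗₁ α B C D)
    P2 : ∀ A B C D → δˡ (A ⊗₀ B) C D ∘ α A B (C ⊙₀ D)
                     ≈ (α A B C ⊙₁ id) ∘ δˡ A (B ⊗₀ C) D ∘ (id ⊗₁ δˡ B C D)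
    P3 : ∀ A B C D → δˡ A B (C ⊗₀ D) ∘ (id ⊗₁ δʳ B C D)
                     ≈ δʳ (A ⊗₀ B) C D ∘ (δˡ A B C ⊗₁ id) ∘ α A (B ⊙₀ C) D
    P4 : ∀ A B C D → ᾱ (A ⊗₀ B) C D ∘ δˡ A B (C ⊙₀ D)
                     ≈ (δˡ A B C ⊙₁ id) ∘ δˡ A (B ⊙₀ C) D ∘ (id ⊗₁ ᾱ B C D)
    P5 : ∀ A B C D → (id ⊙₁ α B C D) ∘ δʳ A B (C ⊗₀ D)
                     ≈ δʳ A (B ⊗₀ C) D ∘ (δʳ A B C ⊗₁ id) ∘ α (A ⊙₀ B) C D
    P6 : ∀ A B C D → (δʳ A B C ⊙₁ id) ∘ δˡ (A ⊙₀ B) C D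
                     ≈ ᾱ A (B ⊗₀ C) D ∘ (id ⊙₁ δˡ B C D) ∘ δʳ A B (C ⊙₀ D)
    P7 : ∀ A B C D → δʳ (A ⊙₀ B) C D ∘ (ᾱ A B C ⊗₁ id)
                     ≈ ᾱ A B (C ⊗₀ D) ∘ (id ⊙₁ δʳ B C D) ∘ δʳ A (B ⊙₀ C) D
    P8 : ∀ A B C D → ᾱ (A ⊙₀ B) C D ∘ ᾱ A B (C ⊙₀ D)
                     ≈ (ᾱ A B C ⊙₁ id) ∘ ᾱ A (B ⊙₀ C) D ∘ (id ⊙₁ ᾱ B C D)

record Tidy {o ℓ e} (C : LDCategory o ℓ e) : Set o where
  open LDCategory C
  field
    ⊗-injective : ∀ {A₁ A₂ B₁ B₂} → A₁ ⊗₀ A₂ ≡ B₁ ⊗₀ B₂ → (A₁ ≡ B₁) × (A₂ ≡ B₂)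
    ⊙-injective : ∀ {A₁ A₂ B₁ B₂} → A₁ ⊙₀ A₂ ≡ B₁ ⊙₀ B₂ → (A₁ ≡ B₁) × (A₂ ≡ B₂)
    ⊗≢⊙         : ∀ {A₁ A₂ B₁ B₂} → ¬ (A₁ ⊗₀ A₂ ≡ B₁ ⊙₀ B₂)

-- The free monoid 𝔜 on the formal letters α, α⁻¹ (word g ∷ u = "g u",
-- g applied last).

data Letter : Set where
  αw α⁻¹w : Letter

Word : Set
Word = List Letter

module Tau {o ℓ e} (C : LDCategory o ℓ e) where
  open LDCategory C

  -- Args u ≅ 𝒞^{|u|}: a tuple of |u| objects, split the way the
  -- recursive definition consumes them:
  --   Args (α u)   = A₁ , (A₂ … A_{|u|+1})
  --   Args (α⁻¹ u) = (A₁ … A_{|u|}) , A_{|u|+1}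
  Args : Word → Set o
  Args []          = ⊤
  Args (αw   ∷ u) = Obj × Args u
  Args (α⁻¹w ∷ u) = Args u × Obj

  module _ {H L R : Obj} (f : H ⇒ L ⊗₀ R) where
    Hf Lf Rf : (u : Word) → Args u → Obj
    Hf []          _       = H
    Hf (αw   ∷ u) (A , X) = A ⊗₀ Hf u X
    Hf (α⁻¹w ∷ u) (X , A) = Hf u X ⊗₀ A
    Lf []          _       = L
    Lf (αw   ∷ u) (A , X) = A ⊗₀ Lf u X
    Lf (α⁻¹w ∷ u) (X , A) = Lf u X
    Rf []          _       = R
    Rf (αw   ∷ u) (A , X) = Rf u X
    Rf (α⁻¹w ∷ u) (X , A) = Rf u X ⊗₀ A

    τ : (u : Word) (X : Args u) → Hf u X ⇒ Lf u X ⊗₀ Rf u X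
    τ []          _       = f
    τ (αw   ∷ u) (A , X) = α A (Lf u X) (Rf u X) ∘ (id ⊗₁ τ u X)
    τ (α⁻¹w ∷ u) (X , A) = α⁻¹ (Lf u X) (Rf u X) A ∘ (τ u X ⊗₁ id)

-- Each identity only involves the last one or two steps of τ, so it is a statement about
-- an arbitrary morphism t : P ⇒ L ⊗ R (standing for τ_u) extended on the left by
-- α ∘ (A ⊗ t) or on the right by α⁻¹ ∘ (t ⊗ A). The three identities involving α follow
-- from naturality of α and the pentagon P1, solved for the appropriate associator; the
-- three involving α⁻¹ are their conjugates by the corresponding isomorphisms.
module Submission where

open import Defs
open import Data.Product using (_×_; _,_)
open import Data.List using (_∷_)
open import Relation.Binary.Bundles using (Setoid)
open import Relation.Binary.Structures using (IsEquivalence)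
import Relation.Binary.Reasoning.Setoid as SetoidReasoning

module LDCategoryProperties {o ℓ e} (C : LDCategory o ℓ e) where
  open LDCategory C

  hom-setoid : Obj → Obj → Setoid ℓ e
  hom-setoid A B = record { isEquivalence = equiv {A} {B} }

  module _ {A B : Obj} where
    open IsEquivalence (equiv {A} {B}) public
      using () renaming (refl to ≈-refl; sym to ≈-sym; trans to ≈-trans)
    open SetoidReasoning (hom-setoid A B) public

  infixr 4 _⟩∘⟨_ refl⟩∘⟨_
  infixl 5 _⟩∘⟨refl

  _⟩∘⟨_ : ∀ {A B C} {f h : B ⇒ C} {g i : A ⇒ B} → f ≈ h → g ≈ i → f ∘ g ≈ h ∘ i
  _⟩∘⟨_ = ∘-resp-≈

  refl⟩∘⟨_ : ∀ {A B C} {f : B ⇒ C} {g i : A ⇒ B} → g ≈ i → f ∘ g ≈ f ∘ i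
  refl⟩∘⟨ p = ≈-refl ⟩∘⟨ p

  _⟩∘⟨refl : ∀ {A B C} {f h : B ⇒ C} {g : A ⇒ B} → f ≈ h → f ∘ g ≈ h ∘ g
  p ⟩∘⟨refl = p ⟩∘⟨ ≈-refl

  sym-assoc : ∀ {A B C D} {f : A ⇒ B} {g : B ⇒ C} {h : C ⇒ D} → h ∘ (g ∘ f) ≈ (h ∘ g) ∘ f
  sym-assoc = ≈-sym assoc

  pullˡ : ∀ {A B C D} {a : C ⇒ D} {b : B ⇒ C} {c : B ⇒ D} {f : A ⇒ B} →
          a ∘ b ≈ c → a ∘ (b ∘ f) ≈ c ∘ f
  pullˡ p = ≈-trans sym-assoc (p ⟩∘⟨refl)

  pullʳ : ∀ {A B C D} {a : C ⇒ D} {b : B ⇒ C} {c : A ⇒ B} {d : A ⇒ C} →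
          b ∘ c ≈ d → (a ∘ b) ∘ c ≈ a ∘ d
  pullʳ p = ≈-trans assoc (refl⟩∘⟨ p)

  switch-fromtoˡ : ∀ {A B C} {b : B ⇒ C} {b' : C ⇒ B} {S : A ⇒ B} {T : A ⇒ C} →
                   b' ∘ b ≈ id → b ∘ S ≈ T → S ≈ b' ∘ T
  switch-fromtoˡ {b = b} {b'} {S} {T} b'b≈id bS≈T = begin
    S              ≈⟨ ≈-sym identityˡ ⟩
    id ∘ S         ≈⟨ ≈-sym b'b≈id ⟩∘⟨refl ⟩
    (b' ∘ b) ∘ S   ≈⟨ pullʳ bS≈T ⟩
    b' ∘ T         ∎

  switch-fromtoʳ : ∀ {A B C} {a : A ⇒ B} {a' : B ⇒ A} {S : B ⇒ C} {T : A ⇒ C} →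
                   a ∘ a' ≈ id → S ∘ a ≈ T → S ≈ T ∘ a'
  switch-fromtoʳ {a = a} {a'} {S} {T} aa'≈id Sa≈T = begin
    S              ≈⟨ ≈-sym identityʳ ⟩
    S ∘ id         ≈⟨ refl⟩∘⟨ ≈-sym aa'≈id ⟩
    S ∘ (a ∘ a')   ≈⟨ pullˡ Sa≈T ⟩
    T ∘ a'         ∎

  conjugate : ∀ {A B C D} {a : A ⇒ B} {a' : B ⇒ A} {b : C ⇒ D} {b' : D ⇒ C}
              {S : A ⇒ C} {T : B ⇒ D} →
              a ∘ a' ≈ id → b' ∘ b ≈ id → T ∘ a ≈ b ∘ S → S ∘ a' ≈ b' ∘ T
  conjugate aa'≈id b'b≈id Ta≈bS =
    switch-fromtoˡ b'b≈id (≈-trans sym-assoc (≈-sym (switch-fromtoʳ aa'≈id Ta≈bS)))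

  inverse-∘ : ∀ {A B C} {f : A ⇒ B} {f' : B ⇒ A} {g : B ⇒ C} {g' : C ⇒ B} →
              f' ∘ f ≈ id → g' ∘ g ≈ id → (f' ∘ g') ∘ (g ∘ f) ≈ id
  inverse-∘ {f = f} {f'} {g} {g'} f'f≈id g'g≈id = begin
    (f' ∘ g') ∘ (g ∘ f)   ≈⟨ pullʳ (pullˡ g'g≈id) ⟩
    f' ∘ (id ∘ f)         ≈⟨ refl⟩∘⟨ identityˡ ⟩
    f' ∘ f                ≈⟨ f'f≈id ⟩
    id                    ∎

  id⊗-∘ : ∀ {A B C D} {f : B ⇒ C} {g : D ⇒ B} → (id {A} ⊗₁ f) ∘ (id ⊗₁ g) ≈ id ⊗₁ (f ∘ g)
  id⊗-∘ = ≈-trans (≈-sym ⊗-homomorphism) (⊗-resp-≈ identityˡ ≈-refl)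

  ⊗id-∘ : ∀ {A B C D} {f : B ⇒ C} {g : D ⇒ B} → (f ⊗₁ id {A}) ∘ (g ⊗₁ id) ≈ (f ∘ g) ⊗₁ id
  ⊗id-∘ = ≈-trans (≈-sym ⊗-homomorphism) (⊗-resp-≈ ≈-refl identityˡ)

  id⊗-inverse : ∀ {A B C} {f : B ⇒ C} {f' : C ⇒ B} → f' ∘ f ≈ id → (id {A} ⊗₁ f') ∘ (id ⊗₁ f) ≈ id
  id⊗-inverse f'f≈id = ≈-trans id⊗-∘ (≈-trans (⊗-resp-≈ ≈-refl f'f≈id) ⊗-identity)

  ⊗id-inverse : ∀ {A B C} {f : B ⇒ C} {f' : C ⇒ B} → f' ∘ f ≈ id → (f' ⊗₁ id {A}) ∘ (f ⊗₁ id) ≈ id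
  ⊗id-inverse f'f≈id = ≈-trans ⊗id-∘ (≈-trans (⊗-resp-≈ f'f≈id ≈-refl) ⊗-identity)

  α-natural₁ : ∀ {A A' B C} (h : A ⇒ A') →
               α A' B C ∘ (h ⊗₁ id) ≈ ((h ⊗₁ id) ⊗₁ id) ∘ α A B C
  α-natural₁ h = ≈-trans (refl⟩∘⟨ ⊗-resp-≈ ≈-refl (≈-sym ⊗-identity)) (α-natural h id id)

  α-natural₂ : ∀ {A B B' C} (h : B ⇒ B') →
               α A B' C ∘ (id ⊗₁ (h ⊗₁ id)) ≈ ((id ⊗₁ h) ⊗₁ id) ∘ α A B C
  α-natural₂ h = α-natural id h id

  α-natural₃ : ∀ {A B C C'} (h : C ⇒ C') →
               α A B C' ∘ (id ⊗₁ (id ⊗₁ h)) ≈ (id ⊗₁ h) ∘ α A B C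
  α-natural₃ h = ≈-trans (α-natural id id h) (⊗-resp-≈ ⊗-identity ≈-refl ⟩∘⟨refl)

  pentagon-α⁻¹ˡ : ∀ A B C D →
    α⁻¹ (A ⊗₀ B) C D ∘ ((α A B C ⊗₁ id) ∘ α A (B ⊗₀ C) D) ≈ α A B (C ⊗₀ D) ∘ (id ⊗₁ α⁻¹ B C D)
  pentagon-α⁻¹ˡ A B C D =
    ≈-sym (conjugate (id⊗-inverse α-isoʳ) α-isoˡ (≈-trans assoc (≈-sym (P1 A B C D))))

  pentagon-α⁻¹ʳ : ∀ A B C D →
    α⁻¹ A (B ⊗₀ C) D ∘ ((α⁻¹ A B C ⊗₁ id) ∘ α (A ⊗₀ B) C D) ≈ (id ⊗₁ α B C D) ∘ α⁻¹ A B (C ⊗₀ D)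
  pentagon-α⁻¹ʳ A B C D = ≈-trans sym-assoc (≈-sym
    (conjugate α-isoʳ (inverse-∘ α-isoˡ (⊗id-inverse α-isoˡ)) (≈-trans (P1 A B C D) sym-assoc)))

  -- τ (αw ∷ u) (A , X) and τ (α⁻¹w ∷ u) (X , A) are definitionally
  -- extendˡ A (τ u X) and extendʳ (τ u X) A.

  extendˡ : ∀ {P L R} (A : Obj) → P ⇒ L ⊗₀ R → A ⊗₀ P ⇒ (A ⊗₀ L) ⊗₀ R
  extendˡ A t = α A _ _ ∘ (id ⊗₁ t)

  extendʳ : ∀ {P L R} → P ⇒ L ⊗₀ R → (A : Obj) → P ⊗₀ A ⇒ L ⊗₀ (R ⊗₀ A)
  extendʳ t A = α⁻¹ _ _ A ∘ (t ⊗₁ id)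

  module _ {P L R : Obj} (t : P ⇒ L ⊗₀ R) where

    extendˡ-⊗ : ∀ A₁ A₂ → extendˡ (A₁ ⊗₀ A₂) t ∘ α A₁ A₂ P
                          ≈ (α A₁ A₂ L ⊗₁ id) ∘ extendˡ A₁ (extendˡ A₂ t)
    extendˡ-⊗ A₁ A₂ = begin
      (α (A₁ ⊗₀ A₂) L R ∘ (id ⊗₁ t)) ∘ α A₁ A₂ P
        ≈⟨ pullʳ (≈-sym (α-natural₃ t)) ⟩
      α (A₁ ⊗₀ A₂) L R ∘ (α A₁ A₂ (L ⊗₀ R) ∘ (id ⊗₁ (id ⊗₁ t)))
        ≈⟨ pullˡ (P1 A₁ A₂ L R) ⟩
      ((α A₁ A₂ L ⊗₁ id) ∘ α A₁ (A₂ ⊗₀ L) R ∘ (id ⊗₁ α A₂ L R)) ∘ (id ⊗₁ (id ⊗₁ t))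
        ≈⟨ pullʳ (pullʳ id⊗-∘) ⟩
      (α A₁ A₂ L ⊗₁ id) ∘ α A₁ (A₂ ⊗₀ L) R ∘ (id ⊗₁ (α A₂ L R ∘ (id ⊗₁ t)))
        ∎

    extendʳ-extendˡ : ∀ A₁ A → extendʳ (extendˡ A₁ t) A ∘ α A₁ P A ≈ extendˡ A₁ (extendʳ t A)
    extendʳ-extendˡ A₁ A = begin
      (α⁻¹ (A₁ ⊗₀ L) R A ∘ ((α A₁ L R ∘ (id ⊗₁ t)) ⊗₁ id)) ∘ α A₁ P A
        ≈⟨ pullʳ (≈-sym ⊗id-∘ ⟩∘⟨refl) ⟩
      α⁻¹ (A₁ ⊗₀ L) R A ∘ ((α A₁ L R ⊗₁ id) ∘ ((id ⊗₁ t) ⊗₁ id)) ∘ α A₁ P A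
        ≈⟨ refl⟩∘⟨ pullʳ (≈-sym (α-natural₂ t)) ⟩
      α⁻¹ (A₁ ⊗₀ L) R A ∘ (α A₁ L R ⊗₁ id) ∘ α A₁ (L ⊗₀ R) A ∘ (id ⊗₁ (t ⊗₁ id))
        ≈⟨ ≈-trans (refl⟩∘⟨ sym-assoc) sym-assoc ⟩
      (α⁻¹ (A₁ ⊗₀ L) R A ∘ (α A₁ L R ⊗₁ id) ∘ α A₁ (L ⊗₀ R) A) ∘ (id ⊗₁ (t ⊗₁ id))
        ≈⟨ pentagon-α⁻¹ˡ A₁ L R A ⟩∘⟨refl ⟩
      (α A₁ L (R ⊗₀ A) ∘ (id ⊗₁ α⁻¹ L R A)) ∘ (id ⊗₁ (t ⊗₁ id))
        ≈⟨ pullʳ id⊗-∘ ⟩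
      α A₁ L (R ⊗₀ A) ∘ (id ⊗₁ (α⁻¹ L R A ∘ (t ⊗₁ id)))
        ∎

    extendʳ-⊗ : ∀ A B → extendʳ (extendʳ t A) B ∘ α P A B
                        ≈ (id ⊗₁ α R A B) ∘ extendʳ t (A ⊗₀ B)
    extendʳ-⊗ A B = begin
      (α⁻¹ L (R ⊗₀ A) B ∘ ((α⁻¹ L R A ∘ (t ⊗₁ id)) ⊗₁ id)) ∘ α P A B
        ≈⟨ pullʳ (≈-sym ⊗id-∘ ⟩∘⟨refl) ⟩
      α⁻¹ L (R ⊗₀ A) B ∘ ((α⁻¹ L R A ⊗₁ id) ∘ ((t ⊗₁ id) ⊗₁ id)) ∘ α P A B
        ≈⟨ refl⟩∘⟨ pullʳ (≈-sym (α-natural₁ t)) ⟩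
      α⁻¹ L (R ⊗₀ A) B ∘ (α⁻¹ L R A ⊗₁ id) ∘ α (L ⊗₀ R) A B ∘ (t ⊗₁ id)
        ≈⟨ ≈-trans (refl⟩∘⟨ sym-assoc) sym-assoc ⟩
      (α⁻¹ L (R ⊗₀ A) B ∘ (α⁻¹ L R A ⊗₁ id) ∘ α (L ⊗₀ R) A B) ∘ (t ⊗₁ id)
        ≈⟨ pentagon-α⁻¹ʳ L R A B ⟩∘⟨refl ⟩
      ((id ⊗₁ α R A B) ∘ α⁻¹ L R (A ⊗₀ B)) ∘ (t ⊗₁ id)
        ≈⟨ assoc ⟩
      (id ⊗₁ α R A B) ∘ α⁻¹ L R (A ⊗₀ B) ∘ (t ⊗₁ id)
        ∎

    extendˡ-⊗⁻¹ : ∀ A₁ A₂ → extendˡ A₁ (extendˡ A₂ t) ∘ α⁻¹ A₁ A₂ P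
                            ≈ (α⁻¹ A₁ A₂ L ⊗₁ id) ∘ extendˡ (A₁ ⊗₀ A₂) t
    extendˡ-⊗⁻¹ A₁ A₂ = conjugate α-isoʳ (⊗id-inverse α-isoˡ) (extendˡ-⊗ A₁ A₂)

    extendˡ-extendʳ : ∀ A₁ A → extendˡ A₁ (extendʳ t A) ∘ α⁻¹ A₁ P A ≈ extendʳ (extendˡ A₁ t) A
    extendˡ-extendʳ A₁ A = ≈-sym (switch-fromtoʳ α-isoʳ (extendʳ-extendˡ A₁ A))

    extendʳ-⊗⁻¹ : ∀ A B → extendʳ t (A ⊗₀ B) ∘ α⁻¹ P A B
                          ≈ (id ⊗₁ α⁻¹ R A B) ∘ extendʳ (extendʳ t A) B
    extendʳ-⊗⁻¹ A B = conjugate α-isoʳ (id⊗-inverse α-isoˡ) (extendʳ-⊗ A B)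

lemma3p8 : ∀ {o ℓ e} (C : LDCategory o ℓ e) → Tidy C →
    let open LDCategory C
        open Tau C
    in ∀ {H L R : Obj} (f : H ⇒ L ⊗₀ R) (u : Word) →
      -- τ_{αu} ∘ α = (α ⊗ id) ∘ τ_{ααu}
      (∀ A₁ A₂ X → τ f (αw ∷ u) (A₁ ⊗₀ A₂ , X) ∘ α A₁ A₂ (Hf f u X)
                   ≈ (α A₁ A₂ (Lf f u X) ⊗₁ id) ∘ τ f (αw ∷ αw ∷ u) (A₁ , A₂ , X))
      -- τ_{α⁻¹αu} ∘ α = τ_{αα⁻¹u}
      × (∀ A₁ X A → τ f (α⁻¹w ∷ αw ∷ u) ((A₁ , X) , A) ∘ α A₁ (Hf f u X) A
                   ≈ τ f (αw ∷ α⁻¹w ∷ u) (A₁ , (X , A)))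
      -- τ_{α⁻¹α⁻¹u} ∘ α = (id ⊗ α) ∘ τ_{α⁻¹u}
      × (∀ X A B → τ f (α⁻¹w ∷ α⁻¹w ∷ u) ((X , A) , B) ∘ α (Hf f u X) A B
                   ≈ (id ⊗₁ α (Rf f u X) A B) ∘ τ f (α⁻¹w ∷ u) (X , A ⊗₀ B))
      -- τ_{α⁻¹u} ∘ α⁻¹ = (id ⊗ α⁻¹) ∘ τ_{α⁻¹α⁻¹u}
      × (∀ X A B → τ f (α⁻¹w ∷ u) (X , A ⊗₀ B) ∘ α⁻¹ (Hf f u X) A B
                   ≈ (id ⊗₁ α⁻¹ (Rf f u X) A B) ∘ τ f (α⁻¹w ∷ α⁻¹w ∷ u) ((X , A) , B))
      -- τ_{αα⁻¹u} ∘ α⁻¹ = τ_{α⁻¹αu}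
      × (∀ A₁ X A → τ f (αw ∷ α⁻¹w ∷ u) (A₁ , (X , A)) ∘ α⁻¹ A₁ (Hf f u X) A
                   ≈ τ f (α⁻¹w ∷ αw ∷ u) ((A₁ , X) , A))
      -- τ_{ααu} ∘ α⁻¹ = (α⁻¹ ⊗ id) ∘ τ_{αu}
      × (∀ A₁ A₂ X → τ f (αw ∷ αw ∷ u) (A₁ , A₂ , X) ∘ α⁻¹ A₁ A₂ (Hf f u X)
                   ≈ (α⁻¹ A₁ A₂ (Lf f u X) ⊗₁ id) ∘ τ f (αw ∷ u) (A₁ ⊗₀ A₂ , X))
lemma3p8 C _ f u =
    (λ A₁ A₂ X → extendˡ-⊗ (τ f u X) A₁ A₂)
  , (λ A₁ X A → extendʳ-extendˡ (τ f u X) A₁ A)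
  , (λ X A B → extendʳ-⊗ (τ f u X) A B)
  , (λ X A B → extendʳ-⊗⁻¹ (τ f u X) A B)
  , (λ A₁ X A → extendˡ-extendʳ (τ f u X) A₁ A)
  , (λ A₁ A₂ X → extendˡ-⊗⁻¹ (τ f u X) A₁ A₂)
  where
  open LDCategoryProperties C
  open Tau C
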